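{- For every composite number $a\in\mathbb N$ there exist at least two distinct bases $b,c\in\mathbb N$, $b,c\ge2$, such that $a$ is antipalindromic both in base $b$ and in base $c$.
   Context: For $b\in\mathbb N$, $b\ge2$, write a natural number $x$ in base $b$ as $x=a_tb^t+\dots+a_1b+a_0$ with digits $a_i\in\{0,1,\dots,b-1\}$ and $a_t\neq 0$. The number $x$ is called antipalindromic in base $b$ if $a_j=b-1-a_{t-j}$ for all $j\in\{0,1,\dots,t\}$. -}

module Defs where

open import Data.Nat using (ℕ; zero; suc; _+_; _*_; _∸_; _<_; _≤_)
open import Data.List using (List; []; _∷_; reverse; map)
open import Data.List.Relation.Unary.All using (All)
open import Data.Product using (Σ; _×_; ∃-syntax)
open import Relation.Binary.PropositionalEquality using (_≡_; _≢_)

evalMSF : ℕ → List ℕ → ℕ → ℕ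
evalMSF b []       acc = acc
evalMSF b (d ∷ ds) acc = evalMSF b ds (acc * b + d)

value : ℕ → List ℕ → ℕ
value b ds = evalMSF b ds 0

IsRepr : ℕ → ℕ → List ℕ → Set
IsRepr b x ds =
  Σ ℕ λ lead → Σ (List ℕ) λ rest →
    (ds ≡ lead ∷ rest) × (lead ≢ 0) × All (_< b) ds × (value b ds ≡ x)

-- x is antipalindromic in base b: its base-b digits satisfy a_j = b-1-a_{t-j} for all j,
-- i.e. the digit list equals the reversed list with each digit d replaced by (b-1)-d.
-- (The base-b representation is unique, so "its digits" = "some representation's digits".)
Antipalindromic : ℕ → ℕ → Set
Antipalindromic b x =
  ∃[ ds ] (IsRepr b x ds × (ds ≡ map (λ d → (b ∸ 1) ∸ d) (reverse ds)))

-- Write a = p q with 2 ≤ p ≤ q. In base q + 1 the number a has the two digits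
-- p − 1 and q + 1 − p, which sum to q, so a is antipalindromic there. Every
-- x ≥ 1 is also antipalindromic as the single digit x in base 2x + 1, and
-- 2a + 1 > q + 1, so the two bases are distinct.
module Submission where

open import Defs
open import Data.Nat using (ℕ; _≤_)
open import Data.Nat.Primality using (Composite)
open import Data.Product using (Σ; _×_)
open import Relation.Binary.PropositionalEquality using (_≢_)

open import Data.Nat using (suc; _+_; _*_; _∸_; _<_; s≤s; z<s; >-nonZero; nonTrivial⇒n>1)
open import Data.Nat.Properties
open import Data.Nat.Divisibility using (quotient; quotient>1; m∣n⇒n≡m*quotient; m∣n⇒n≡quotient*m)
open import Data.Nat.Primality using (composite)
open import Data.List using ([]; _∷_)
open import Data.List.Relation.Unary.All using ([]; _∷_)
open import Data.Product using (_,_; ∃₂)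
open import Data.Sum using (inj₁; inj₂)
open import Relation.Binary.PropositionalEquality using (_≡_; refl; sym; cong; cong₂; subst; module ≡-Reasoning)

antipalindromic-digit : ∀ x → x ≢ 0 → Antipalindromic (suc (x + x)) x
antipalindromic-digit x x≢0 =
  x ∷ [] , (x , [] , refl , x≢0 , s≤s (m≤m+n x x) ∷ [] , refl) , cong (_∷ []) (sym (m+n∸n≡m x x))

antipalindromic-twoDigit : ∀ {b d} → d ≢ 0 → d < b → Antipalindromic b (d * b + (b ∸ 1 ∸ d))
antipalindromic-twoDigit {suc b-1} {d} d≢0 (s≤s d≤b-1) =
  d ∷ b-1 ∸ d ∷ [] ,
  (d , _ , refl , d≢0 , s≤s d≤b-1 ∷ s≤s (m∸n≤m b-1 d) ∷ [] , refl) ,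
  cong₂ (λ e f → e ∷ f ∷ []) (sym (m∸[m∸n]≡n d≤b-1)) refl

[1+m]*n≡m*[1+n]+[n∸m] : ∀ {m q} → m ≤ q → suc m * q ≡ m * suc q + (q ∸ m)
[1+m]*n≡m*[1+n]+[n∸m] {m} {q} m≤q = begin
  q + m * q              ≡⟨ cong (_+ m * q) (sym (m+[n∸m]≡n m≤q)) ⟩
  m + (q ∸ m) + m * q    ≡⟨ +-assoc m (q ∸ m) (m * q) ⟩
  m + (q ∸ m + m * q)    ≡⟨ cong (m +_) (+-comm (q ∸ m) (m * q)) ⟩
  m + (m * q + (q ∸ m))  ≡⟨ sym (+-assoc m (m * q) (q ∸ m)) ⟩
  m + m * q + (q ∸ m)    ≡⟨ cong (_+ (q ∸ m)) (sym (*-suc m q)) ⟩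
  m * suc q + (q ∸ m)    ∎
  where open ≡-Reasoning

antipalindromic-product : ∀ {p q} → 2 ≤ p → p ≤ suc q → Antipalindromic (suc q) (p * q)
antipalindromic-product {suc m@(suc _)} {q} (s≤s (s≤s _)) (s≤s m≤q) =
  subst (Antipalindromic (suc q)) (sym ([1+m]*n≡m*[1+n]+[n∸m] m≤q))
        (antipalindromic-twoDigit (λ ()) (s≤s m≤q))

composite⇒orderedFactors : ∀ {a} → Composite a → ∃₂ λ p q → 2 ≤ p × p ≤ q × a ≡ p * q
composite⇒orderedFactors (composite {d} d<a d∣a) with ≤-total d (quotient d∣a)
... | inj₁ d≤k = d , quotient d∣a , nonTrivial⇒n>1 d , d≤k , m∣n⇒n≡m*quotient d∣a
... | inj₂ k≤d = quotient d∣a , d , quotient>1 d∣a d<a , k≤d , m∣n⇒n≡quotient*m d∣a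

mainTheorem13 : (a : ℕ) → Composite a →
    Σ ℕ λ b → Σ ℕ λ c →
    (b ≢ c) × (2 ≤ b) × (2 ≤ c) × Antipalindromic b a × Antipalindromic c a
mainTheorem13 a a-composite with composite⇒orderedFactors a-composite
... | p , q , 2≤p , p≤q , refl =
  suc q , suc (a + a) , <⇒≢ b<c , 2≤b , ≤-trans 2≤b (<⇒≤ b<c) ,
  antipalindromic-product 2≤p (m≤n⇒m≤1+n p≤q) , antipalindromic-digit a (m<n⇒n≢0 q<a)
  where
  2≤q : 2 ≤ q
  2≤q = ≤-trans 2≤p p≤q
  q<a : q < p * q
  q<a = subst (q <_) (*-comm q p) (m<m*n q p {{>-nonZero (<-trans z<s 2≤q)}} 2≤p)
  b<c : suc q < suc (p * q + p * q)
  b<c = s≤s (<-≤-trans q<a (m≤m+n _ _))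
  2≤b : 2 ≤ suc q
  2≤b = m≤n⇒m≤1+n 2≤q
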